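{- Let $N$ be a set (of node objects) not containing the symbol $\mathsf{null}$, and let $\mathrm{next}, \mathrm{prev} : N \to N \cup \{\mathsf{null}\}$ be functions. Let $n \ge 0$ be an integer with $n \le 2^{31}-1$, let $\sigma = (\sigma[0], \dots, \sigma[n-1])$ be a finite sequence of elements of $N$, and let $\mathit{first}, \mathit{last} \in N \cup \{\mathsf{null}\}$. Suppose the following linked-list invariant holds: (i) if $n = 0$ then $\mathit{first} = \mathit{last} = \mathsf{null}$; (ii) if $n > 0$ then $\mathit{first} = \sigma[0]$, $\mathit{last} = \sigma[n-1]$, $\mathrm{prev}(\mathit{first}) = \mathsf{null}$ and $\mathrm{next}(\mathit{last}) = \mathsf{null}$; (iii) for every index $0 < i < n$, $\mathrm{prev}(\sigma[i]) = \sigma[i-1]$; (iv) for every index $0 \le i < n-1$, $\mathrm{next}(\sigma[i]) = \sigma[i+1]$. Then $\sigma$ is acyclic: for all indices $0 \le i < j < n$, $\sigma[i] \neq \sigma[j]$.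
   Context: This models the class invariant of a doubly-linked list (Java's LinkedList with a ghost sequence field nodeList $=\sigma$ whose length equals the cached size field): each node has a prev and a next reference, which may be null; all entries of $\sigma$ are non-null nodes; $\mathit{first}$ and $\mathit{last}$ are the list's references to its first and last node. Equality of nodes is object identity, so equal nodes have equal next and prev values. -}

module Defs where

open import Data.Nat using (ℕ; zero; suc; _≤_; _^_; _∸_)
open import Data.Fin using (Fin; toℕ)
open import Data.Maybe using (Maybe; just; nothing)
open import Data.Vec using (Vec; lookup)
open import Data.Product using (_×_)
open import Relation.Binary.PropositionalEquality using (_≡_)

-- N ∪ {null} is modelled as Maybe N, with null = nothing.
-- Linked-list invariant for the ghost sequence σ of length n.
record LinkedListInv {N : Set} (next prev : N → Maybe N) (n : ℕ)
                     (σ : Vec N n) (first last : Maybe N) : Set where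
  field
    empty : n ≡ 0 → (first ≡ nothing) × (last ≡ nothing)
    firstIs : ∀ (i : Fin n) → toℕ i ≡ 0 → first ≡ just (lookup σ i)
    lastIs  : ∀ (i : Fin n) → suc (toℕ i) ≡ n → last ≡ just (lookup σ i)
    prevFirst : ∀ (x : N) → first ≡ just x → prev x ≡ nothing
    nextLast  : ∀ (x : N) → last ≡ just x → next x ≡ nothing
    prevLink : ∀ (i j : Fin n) → toℕ j ≡ suc (toℕ i) → prev (lookup σ j) ≡ just (lookup σ i)
    nextLink : ∀ (i j : Fin n) → toℕ j ≡ suc (toℕ i) → next (lookup σ i) ≡ just (lookup σ j)

-- If σ[i] = σ[j] with i < j, applying prev to both sides gives σ[i-1] = σ[j-1]; descending
-- to i = 0 leaves σ[0] = σ[j-i], where prev is null on the left and σ[j-i-1] on the right.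
module Submission where

open import Defs
open import Data.Nat using (ℕ; zero; suc; _≤_; _<_; _^_; _∸_; s≤s; z≤n)
open import Data.Nat.Properties using (suc-injective; ≤-<-trans)
open import Data.Fin using (Fin; zero; suc; toℕ; inject₁; pred)
open import Data.Fin.Properties using (toℕ-inject₁)
open import Data.Maybe using (Maybe; just; nothing)
open import Data.Maybe.Properties using (just-injective)
open import Data.Vec using (Vec; lookup)
open import Relation.Binary.PropositionalEquality
  using (_≡_; _≢_; refl; sym; trans; cong; subst₂; module ≡-Reasoning)
open import Relation.Nullary using (¬_)

module _ {N : Set} {prev : N → Maybe N} {n : ℕ} {σ : Vec N n}
         (prev-head : ∀ (i : Fin n) → toℕ i ≡ 0 → prev (lookup σ i) ≡ nothing)
         (prev-link : ∀ (i j : Fin n) → toℕ j ≡ suc (toℕ i) →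
                      prev (lookup σ j) ≡ just (lookup σ i))
         where

  prev-lookup-pred : ∀ (j : Fin n) → 0 < toℕ j → prev (lookup σ j) ≡ just (lookup σ (pred j))
  prev-lookup-pred (suc j) _ = prev-link (inject₁ j) (suc j) (cong suc (sym (toℕ-inject₁ j)))

  head-distinct : ∀ (i j : Fin n) → toℕ i ≡ 0 → 0 < toℕ j → lookup σ i ≢ lookup σ j
  head-distinct i j i≡0 0<j σi≡σj with begin
    nothing                  ≡⟨ sym (prev-head i i≡0) ⟩
    prev (lookup σ i)        ≡⟨ cong prev σi≡σj ⟩
    prev (lookup σ j)        ≡⟨ prev-lookup-pred j 0<j ⟩
    just (lookup σ (pred j)) ∎
    where open ≡-Reasoning
  ... | ()

  lookup-pred-cong : ∀ (i j : Fin n) → 0 < toℕ i → 0 < toℕ j →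
                     lookup σ i ≡ lookup σ j → lookup σ (pred i) ≡ lookup σ (pred j)
  lookup-pred-cong i j 0<i 0<j σi≡σj = just-injective (begin
    just (lookup σ (pred i)) ≡⟨ sym (prev-lookup-pred i 0<i) ⟩
    prev (lookup σ i)        ≡⟨ cong prev σi≡σj ⟩
    prev (lookup σ j)        ≡⟨ prev-lookup-pred j 0<j ⟩
    just (lookup σ (pred j)) ∎)
    where open ≡-Reasoning

  lookup-distinct : ∀ k (i j : Fin n) → toℕ i ≡ k → toℕ i < toℕ j →
                    lookup σ i ≢ lookup σ j
  lookup-distinct zero    i       j       i≡0 i<j =
    head-distinct i j i≡0 (≤-<-trans z≤n i<j)
  lookup-distinct (suc k) (suc i) (suc j) i≡k (s≤s i<j) σi≡σj =
    lookup-distinct k (inject₁ i) (inject₁ j) i′≡k i′<j′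
      (lookup-pred-cong (suc i) (suc j) (s≤s z≤n) (s≤s z≤n) σi≡σj)
    where
    i′≡k : toℕ (inject₁ i) ≡ k
    i′≡k = trans (toℕ-inject₁ i) (suc-injective i≡k)

    i′<j′ : toℕ (inject₁ i) < toℕ (inject₁ j)
    i′<j′ = subst₂ _<_ (sym (toℕ-inject₁ i)) (sym (toℕ-inject₁ j)) i<j

mainTheorem1 : {N : Set} (next prev : N → Maybe N) (n : ℕ) → n ≤ 2 ^ 31 ∸ 1 →
    (σ : Vec N n) (first last : Maybe N) →
    LinkedListInv next prev n σ first last →
    ∀ (i j : Fin n) → toℕ i < toℕ j → ¬ (lookup σ i ≡ lookup σ j)
mainTheorem1 next prev n _ σ first last inv i j =
  lookup-distinct {prev = prev} {σ = σ} prev-head prevLink (toℕ i) i j refl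
  where
  open LinkedListInv inv

  prev-head : ∀ (i : Fin n) → toℕ i ≡ 0 → prev (lookup σ i) ≡ nothing
  prev-head i i≡0 = prevFirst (lookup σ i) (firstIs i i≡0)
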